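{- A program $p$ of the split fireball calculus is normal (has no $\to_{\beta_f}$-reduct) if and only if $p=(f,E)$ for some fireball $f$ and some environment $E$.
   Context: Terms: $t,u ::= x \mid \lambda x.t \mid tu$, up to $\alpha$-equivalence; $t\{x\leftarrow u\}$ is capture-avoiding substitution. Values: $v ::= x \mid \lambda x.t$. Fireballs $f$ and inert terms $i$ are defined by mutual induction: $f ::= v \mid i$ and $i ::= x f_1 \dots f_n$ with $n>0$ (application left-associative). Right evaluation contexts: $C ::= \langle\cdot\rangle \mid t\,C \mid C\,f$, with $C\langle t\rangle$ denoting plugging. Split fireball calculus: environments $E ::= \epsilon \mid [x\leftarrow i]:E$; programs $p=(t,E)$. Reduction: $(C\langle(\lambda x.t)v\rangle,E)\to_{\beta_v}(C\langle t\{x\leftarrow v\}\rangle,E)$ and $(C\langle(\lambda x.t)i\rangle,E)\to_{\beta_i}(C\langle t\rangle,[x\leftarrow i]:E)$; $\to_{\beta_f}=\to_{\beta_v}\cup\to_{\beta_i}$. -}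

module Defs where

open import Data.Nat using (ℕ; zero; suc; _<_; _≟_)
open import Data.List using (List; []; _∷_; _++_)
open import Data.List.Membership.Propositional using (_∉_)
open import Data.Product using (_×_; _,_; Σ)
open import Relation.Nullary using (¬_; yes; no)

-- Pure λ-terms in the locally nameless representation: bound variables are
-- de Bruijn indices (so α-equivalent terms are syntactically equal), free
-- variables are names (natural numbers).
data Term : Set where
  bvar : ℕ → Term
  fvar : ℕ → Term
  lam  : Term → Term
  app  : Term → Term → Term

open-rec : ℕ → Term → Term → Term
open-rec k u (bvar j) with k ≟ j
... | yes _ = u
... | no  _ = bvar j
open-rec k u (fvar x)  = fvar x
open-rec k u (lam t)   = lam (open-rec (suc k) u t)
open-rec k u (app t s) = app (open-rec k u t) (open-rec k u s)

-- t ^ u : for λ-body t, this is t{x←u} (capture-avoiding substitution of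
-- the bound variable by u)
_^_ : Term → Term → Term
t ^ u = open-rec 0 u t

data LCAt : ℕ → Term → Set where
  lc-bvar : ∀ {k j} → j < k → LCAt k (bvar j)
  lc-fvar : ∀ {k x} → LCAt k (fvar x)
  lc-lam  : ∀ {k t} → LCAt (suc k) t → LCAt k (lam t)
  lc-app  : ∀ {k t s} → LCAt k t → LCAt k s → LCAt k (app t s)

LC : Term → Set
LC = LCAt 0

fv : Term → List ℕ
fv (bvar _)  = []
fv (fvar x)  = x ∷ []
fv (lam t)   = fv t
fv (app t s) = fv t ++ fv s

data Value : Term → Set where
  v-var : ∀ x → Value (fvar x)
  v-lam : ∀ t → Value (lam t)

data Fireball : Term → Set
data Inert : Term → Set

data Fireball where
  f-val   : ∀ {t} → Value t → Fireball t
  f-inert : ∀ {t} → Inert t → Fireball t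

data Inert where
  i-var : ∀ {x f} → Fireball f → Inert (app (fvar x) f)
  i-app : ∀ {i f} → Inert i → Fireball f → Inert (app i f)

data Ctx : Set where
  hole : Ctx
  _·C_ : Term → Ctx → Ctx
  _·f_[_] : Ctx → (f : Term) → Fireball f → Ctx

_⟨_⟩ : Ctx → Term → Term
hole ⟨ u ⟩          = u
(t ·C C) ⟨ u ⟩      = app t (C ⟨ u ⟩)
(C ·f f [ _ ]) ⟨ u ⟩ = app (C ⟨ u ⟩) f

data Env : Set where
  ε      : Env
  [_←_∣_]∷_ : (x : ℕ) → (i : Term) → Inert i → Env → Env

names : Env → List ℕ
names ε = []
names ([ x ← i ∣ _ ]∷ E) = x ∷ fv i ++ names E

Program : Set
Program = Term × Env

-- split fireball calculus reduction →βf = →βv ∪ →βi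
-- (in →βi the bound name x is chosen fresh, as licensed by α-equivalence)
data _→βf_ : Program → Program → Set where
  βv : ∀ (C : Ctx) (t v : Term) (E : Env) → Value v →
       (C ⟨ app (lam t) v ⟩ , E) →βf (C ⟨ t ^ v ⟩ , E)
  βi : ∀ (C : Ctx) (t i : Term) (E : Env) (x : ℕ) (ii : Inert i) →
       x ∉ fv (C ⟨ app (lam t) i ⟩) → x ∉ names E →
       (C ⟨ app (lam t) i ⟩ , E) →βf (C ⟨ t ^ fvar x ⟩ , [ x ← i ∣ ii ]∷ E)

Normal : Program → Set
Normal p = ¬ Σ Program (λ q → p →βf q)

{-# OPTIONS --safe #-}
-- A locally closed term is either a fireball or has the shape C⟨(λx.t) f⟩ with f a
-- fireball; such a redex fires by βv if f is a value and by βi (with a fresh name) if f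
-- is inert.  Conversely, a fireball never has an abstraction applied to anything in
-- evaluation position, since inert terms are headed by a variable.
module Submission where

open import Defs
open import Data.Empty using (⊥-elim)
open import Data.List using (List; _++_)
open import Data.List.Extrema.Nat using (max; xs≤max)
open import Data.List.Membership.Propositional using (_∉_)
open import Data.List.Membership.Propositional.Properties using (∈-++⁺ˡ; ∈-++⁺ʳ)
open import Data.List.Relation.Unary.All using (lookup)
open import Data.Nat using (ℕ; suc)
open import Data.Nat.Properties using (1+n≰n)
open import Data.Product using (_×_; _,_; ∃; ∃-syntax; proj₁)
open import Data.Sum using (_⊎_; inj₁; inj₂)
open import Function using (_∘_)
open import Function.Bundles using (_⇔_; mk⇔)
open import Relation.Binary.PropositionalEquality using (_≡_; refl)
open import Relation.Nullary using (¬_)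

fresh-for : (xs : List ℕ) → ∃[ x ] x ∉ xs
fresh-for xs = suc (max 0 xs) , 1+n≰n ∘ lookup (xs≤max 0 xs)

∉-++⁻ˡ : ∀ {x : ℕ} (xs {ys} : List ℕ) → x ∉ xs ++ ys → x ∉ xs
∉-++⁻ˡ xs x∉ = x∉ ∘ ∈-++⁺ˡ

∉-++⁻ʳ : ∀ {x : ℕ} (xs {ys} : List ℕ) → x ∉ xs ++ ys → x ∉ ys
∉-++⁻ʳ xs x∉ = x∉ ∘ ∈-++⁺ʳ xs

Redex : Term → Set
Redex s = ∃[ C ] ∃[ t ] ∃[ f ] Fireball f × s ≡ C ⟨ app (lam t) f ⟩

fireball⊎redex : (t : Term) → LC t → Fireball t ⊎ Redex t
fireball⊎redex (bvar j) (lc-bvar ())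
fireball⊎redex (fvar x) _ = inj₁ (f-val (v-var x))
fireball⊎redex (lam t)  _ = inj₁ (f-val (v-lam t))
fireball⊎redex (app t s) (lc-app lc-t lc-s) with fireball⊎redex s lc-s
... | inj₂ (C , b , f , fb , refl) = inj₂ (t ·C C , b , f , fb , refl)
... | inj₁ fb-s with fireball⊎redex t lc-t
...   | inj₂ (C , b , f , fb , refl) = inj₂ (C ·f s [ fb-s ] , b , f , fb , refl)
...   | inj₁ (f-val (v-var x)) = inj₁ (f-inert (i-var fb-s))
...   | inj₁ (f-val (v-lam b)) = inj₂ (hole , b , s , fb-s , refl)
...   | inj₁ (f-inert i)       = inj₁ (f-inert (i-app i fb-s))

fireball-redex-free : ∀ C t u → ¬ Fireball (C ⟨ app (lam t) u ⟩)
inert-redex-free    : ∀ C t u → ¬ Inert (C ⟨ app (lam t) u ⟩)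

fireball-redex-free hole t u (f-inert (i-app () _))
fireball-redex-free C@(_ ·C _)       t u (f-inert i) = inert-redex-free C t u i
fireball-redex-free C@(_ ·f _ [ _ ]) t u (f-inert i) = inert-redex-free C t u i

inert-redex-free hole t u (i-app () _)
inert-redex-free (_ ·C C) t u (i-var fb)   = fireball-redex-free C t u fb
inert-redex-free (_ ·C C) t u (i-app _ fb) = fireball-redex-free C t u fb
inert-redex-free (hole ·f _ [ _ ]) t u (i-app (i-app () _) _)
inert-redex-free (C@(_ ·C _)       ·f _ [ _ ]) t u (i-app i _) = inert-redex-free C t u i
inert-redex-free (C@(_ ·f _ [ _ ]) ·f _ [ _ ]) t u (i-app i _) = inert-redex-free C t u i

fireball-normal : ∀ {f} (E : Env) → Fireball f → Normal (f , E)
fireball-normal E fb (_ , βv C t _ _ _)       = fireball-redex-free C t _ fb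
fireball-normal E fb (_ , βi C t _ _ _ _ _ _) = fireball-redex-free C t _ fb

redex-reduces : ∀ {s} (E : Env) → Redex s → ∃[ q ] (s , E) →βf q
redex-reduces E (C , t , v , f-val v-v , refl)   = _ , βv C t v E v-v
redex-reduces E (C , t , i , f-inert i-i , refl)
  with fresh-for (fv (C ⟨ app (lam t) i ⟩) ++ names E)
... | x , x∉ = _ , βi C t i E x i-i (∉-++⁻ˡ _ x∉) (∉-++⁻ʳ _ x∉)

proposition3 : (p : Program) → LC (proj₁ p) →
    (Normal p ⇔ ∃ λ (f : Term) → ∃ λ (E : Env) → Fireball f × p ≡ (f , E))
proposition3 (t , E) lc = mk⇔ normal⇒fireball fireball⇒normal
  where
  normal⇒fireball : Normal (t , E) → ∃[ f ] ∃[ E′ ] Fireball f × (t , E) ≡ (f , E′)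
  normal⇒fireball nf with fireball⊎redex t lc
  ... | inj₁ fb = t , E , fb , refl
  ... | inj₂ r  = ⊥-elim (nf (redex-reduces E r))

  fireball⇒normal : ∃[ f ] ∃[ E′ ] Fireball f × (t , E) ≡ (f , E′) → Normal (t , E)
  fireball⇒normal (_ , _ , fb , refl) = fireball-normal E fb
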